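{- Let $M$ be a block matrix with $m\ge1$ square diagonal blocks, where for each $i \in [m]$ the $i$th diagonal block of $M$ is a $k_i$-regular $0,1$ matrix of dimensions $n_i \times n_i$ for integers $n_i \geq k_i>0$, and all of whose other entries are zeros. Then $\mathrm{rank}_{\mathbb{R}}(M) = \mathrm{rank}_{\mathbb{R}}(\overline{M})$, unless $M$ is an all-one matrix.
   Context: A square $0,1$ matrix is $k$-regular if every row and every column has precisely $k$ ones. $\overline{M}$ is the complement of $M$ (zeros and ones swapped). $\mathrm{rank}_{\mathbb{R}}$ is the rank over the reals. -}

module Defs where

open import Data.Nat using (ℕ; zero; suc; _+_)
open import Data.Bool using (Bool; true; false; not)
open import Data.Fin using (Fin; zero; suc; splitAt)
open import Data.Sum using (inj₁; inj₂)
open import Data.Product using (Σ; _×_)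
open import Data.Rational using (ℚ; 0ℚ; 1ℚ) renaming (_+_ to _+ℚ_; _*_ to _*ℚ_)
open import Relation.Binary.PropositionalEquality using (_≡_)
open import Relation.Nullary using (¬_)

Mat01 : ℕ → Set
Mat01 n = Fin n → Fin n → Bool

count : (n : ℕ) → (Fin n → Bool) → ℕ
count zero    v = 0
count (suc n) v with v zero
... | true  = suc (count n (λ i → v (suc i)))
... | false = count n (λ i → v (suc i))

IsRegular : (n k : ℕ) → Mat01 n → Set
IsRegular n k A = ((a : Fin n) → count n (λ b → A a b) ≡ k)
                × ((b : Fin n) → count n (λ a → A a b) ≡ k)

compl : {n : ℕ} → Mat01 n → Mat01 n
compl A a b = not (A a b)

AllOne : {n : ℕ} → Mat01 n → Set
AllOne {n} A = (a b : Fin n) → A a b ≡ true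

sumSizes : (m : ℕ) → (Fin m → ℕ) → ℕ
sumSizes zero    n = 0
sumSizes (suc m) n = n zero + sumSizes m (λ i → n (suc i))

blockDiag : (m : ℕ) (n : Fin m → ℕ) → ((i : Fin m) → Mat01 (n i))
          → Mat01 (sumSizes m n)
blockDiag zero    n B ()
blockDiag (suc m) n B a b with splitAt (n zero) a | splitAt (n zero) b
... | inj₁ a' | inj₁ b' = B zero a' b'
... | inj₂ a' | inj₂ b' = blockDiag m (λ i → n (suc i)) (λ i → B (suc i)) a' b'
... | inj₁ _  | inj₂ _  = false
... | inj₂ _  | inj₁ _  = false

toℚ : Bool → ℚ
toℚ true  = 1ℚ
toℚ false = 0ℚ

sumℚ : (r : ℕ) → (Fin r → ℚ) → ℚ
sumℚ zero    f = 0ℚ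
sumℚ (suc r) f = f zero +ℚ sumℚ r (λ t → f (suc t))

RowsIndependent : {N : ℕ} → Mat01 N → (r : ℕ) → (Fin r → Fin N) → Set
RowsIndependent {N} A r ι =
  (c : Fin r → ℚ) →
  ((j : Fin N) → sumℚ r (λ t → c t *ℚ toℚ (A (ι t) j)) ≡ 0ℚ) →
  (t : Fin r) → c t ≡ 0ℚ

HasRank : {N : ℕ} → Mat01 N → ℕ → Set
HasRank {N} A r =
  Σ (Fin r → Fin N) (λ ι → RowsIndependent A r ι)
  × ((ι : Fin (suc r) → Fin N) → ¬ RowsIndependent A (suc r) ι)

{-# OPTIONS --safe #-}
module Submission where

-- Suppose a rational weighting x of the columns gives every row of a 0,1 matrix A the same
-- weighted sum D ≠ 0, while the total weight S differs from D. If w = Σ c_t A_t is a combination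
-- of rows of A, the same combination of rows of the complement is (Σ c_t) 𝟙 − w, and pairing with
-- x gives ⟨x, w⟩ = (Σ c_t) D. So w = 0 forces Σ c_t = 0 and the complementary combination vanishes
-- too; conversely, if that one vanishes then w = (Σ c_t) 𝟙, hence (Σ c_t) D = (Σ c_t) S and again
-- Σ c_t = 0. Thus A and its complement have the same independent sets of rows, hence equal rank.
-- For the block diagonal matrix, weight the columns of block i by ∏_{l ≠ i} k_l: every row then
-- has weighted sum D = ∏_l k_l, and S = Σ_i n_i ∏_{l ≠ i} k_l exceeds D unless there is a single
-- block with k = n, which is exactly the all-one case.

open import Defs
open import Data.Nat using (ℕ; _≤_; _<_)
open import Data.Fin using (Fin)
open import Function.Bundles using (_⇔_)
open import Relation.Nullary using (¬_)

open import Algebra.Bundles using (Monoid; CommutativeMonoid; CommutativeRing)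
open import Data.Bool using (Bool; true; false; not)
open import Data.Empty using (⊥-elim)
open import Data.Fin using (zero; suc; splitAt)
open import Data.Nat using (zero; suc; z≤n; s≤s; _+_; _*_; >-nonZero)
import Data.Nat.Properties as ℕ
open import Data.Product using (_,_; proj₁)
open import Data.Rational using (ℚ; 0ℚ; 1ℚ; -_; _-_; 1/_; ≢-nonZero)
  renaming (_+_ to _+ℚ_; _*_ to _*ℚ_; _<_ to _<ℚ_; _≤_ to _≤ℚ_; NonZero to NonZeroℚ)
import Data.Rational.Properties as ℚ
open import Data.Sum using (_⊎_; inj₁; inj₂)
open import Data.Vec.Functional using (_++_; replicate)
open import Function using (_∘_)
open import Function.Bundles using (mk⇔; Equivalence)
open import Relation.Binary.PropositionalEquality
  using (_≡_; _≢_; refl; sym; trans; cong; cong₂; subst; ≢-sym; module ≡-Reasoning)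

module _ {c ℓ} (M : Monoid c ℓ) where
  open Monoid M using (Carrier; _≈_; _∙_; setoid; identityˡ; assoc; ∙-congˡ) renaming (sym to ≈-sym)
  open import Algebra.Properties.Monoid.Sum M using (sum; sum-cong-≗)
  open import Relation.Binary.Reasoning.Setoid setoid

  sum-++ : ∀ {m n} (xs : Fin m → Carrier) (ys : Fin n → Carrier) → sum (xs ++ ys) ≈ sum xs ∙ sum ys
  sum-++ {zero}  xs ys = ≈-sym (identityˡ (sum ys))
  sum-++ {suc m} xs ys = begin
    xs zero ∙ sum ((xs ++ ys) ∘ suc)      ≡⟨ cong (xs zero ∙_) (sum-cong-≗ tail-++) ⟩
    xs zero ∙ sum ((xs ∘ suc) ++ ys)      ≈⟨ ∙-congˡ (sum-++ (xs ∘ suc) ys) ⟩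
    xs zero ∙ (sum (xs ∘ suc) ∙ sum ys)   ≈⟨ assoc (xs zero) _ _ ⟨
    sum xs ∙ sum ys                       ∎
    where
    tail-++ : ∀ i → (xs ++ ys) (suc i) ≡ ((xs ∘ suc) ++ ys) i
    tail-++ i with splitAt m i
    ... | inj₁ _ = refl
    ... | inj₂ _ = refl

open import Algebra.Properties.Group ℚ.+-0-group using (x∙y⁻¹≈ε⇒x≈y)
open import Algebra.Properties.CommutativeSemigroup
  (CommutativeMonoid.commutativeSemigroup ℚ.*-1-commutativeMonoid) using (x∙yz≈y∙xz)
open import Algebra.Properties.Semiring.Mult (CommutativeRing.semiring ℚ.+-*-commutativeRing)
  using (_×_; ×-homo-+; ×1-homo-*; ×-assoc-*)
open import Algebra.Properties.Semiring.Sum (CommutativeRing.semiring ℚ.+-*-commutativeRing)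
  using (sum; sum-syntax; sum-cong-≗; sum-replicate; sum-replicate-zero;
         ∑-comm; ∑-distrib-+; *-distribˡ-sum; *-distribʳ-sum)

sumℚ≡sum : ∀ r (f : Fin r → ℚ) → sumℚ r f ≡ sum f
sumℚ≡sum zero    f = refl
sumℚ≡sum (suc r) f = cong (f zero +ℚ_) (sumℚ≡sum r (f ∘ suc))

fromℕ : ℕ → ℚ
fromℕ n = n × 1ℚ

fromℕ-nonNeg : ∀ n → 0ℚ ≤ℚ fromℕ n
fromℕ-nonNeg zero    = ℚ.≤-refl
fromℕ-nonNeg (suc n) = ℚ.+-mono-≤ (ℚ.<⇒≤ (ℚ.positive⁻¹ 1ℚ)) (fromℕ-nonNeg n)

fromℕ-mono-< : ∀ {m n} → m < n → fromℕ m <ℚ fromℕ n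
fromℕ-mono-< {zero}  {suc n} _         = ℚ.+-mono-<-≤ (ℚ.positive⁻¹ 1ℚ) (fromℕ-nonNeg n)
fromℕ-mono-< {suc m} {suc n} (s≤s m<n) = ℚ.+-monoʳ-< 1ℚ (fromℕ-mono-< m<n)

fromℕ-+ : ∀ m n → fromℕ (m + n) ≡ fromℕ m +ℚ fromℕ n
fromℕ-+ = ×-homo-+ 1ℚ

fromℕ-* : ∀ m n → fromℕ (m * n) ≡ fromℕ m *ℚ fromℕ n
fromℕ-* = ×1-homo-*

sum-const : ∀ n (c : ℚ) → sum (replicate n c) ≡ fromℕ n *ℚ c
sum-const n c = begin
  sum (replicate n c)  ≡⟨ sum-replicate n ⟩
  n × c                ≡⟨ cong (n ×_) (sym (ℚ.*-identityˡ c)) ⟩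
  n × (1ℚ *ℚ c)        ≡⟨ sym (×-assoc-* n 1ℚ c) ⟩
  fromℕ n *ℚ c         ∎
  where open ≡-Reasoning

sum-toℚ : ∀ n (v : Fin n → Bool) → sum (toℚ ∘ v) ≡ fromℕ (count n v)
sum-toℚ zero    v = refl
sum-toℚ (suc n) v with v zero
... | true  = cong (1ℚ +ℚ_) (sum-toℚ n (v ∘ suc))
... | false = trans (ℚ.+-identityˡ _) (sum-toℚ n (v ∘ suc))

weightedCount : ∀ {N} → (Fin N → ℚ) → (Fin N → Bool) → ℚ
weightedCount {N} x v = ∑[ j < N ] (x j *ℚ toℚ (v j))

weightedCount-cong : ∀ {N} (x : Fin N → ℚ) {u v : Fin N → Bool} →
                     (∀ j → u j ≡ v j) → weightedCount x u ≡ weightedCount x v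
weightedCount-cong x u≗v = sum-cong-≗ (λ j → cong (λ b → x j *ℚ toℚ b) (u≗v j))

weightedCount-++ : ∀ {m n} (x : Fin m → ℚ) (y : Fin n → ℚ) u v →
                   weightedCount (x ++ y) (u ++ v) ≡ weightedCount x u +ℚ weightedCount y v
weightedCount-++ {m} x y u v =
  trans (sum-cong-≗ blockwise) (sum-++ ℚ.+-0-monoid (λ j → x j *ℚ toℚ (u j)) (λ j → y j *ℚ toℚ (v j)))
  where
  blockwise : ∀ j → (x ++ y) j *ℚ toℚ ((u ++ v) j)
                  ≡ ((λ i → x i *ℚ toℚ (u i)) ++ (λ i → y i *ℚ toℚ (v i))) j
  blockwise j with splitAt m j
  ... | inj₁ _ = refl
  ... | inj₂ _ = refl

weightedCount-const : ∀ n c (v : Fin n → Bool) →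
                      weightedCount (replicate n c) v ≡ c *ℚ fromℕ (count n v)
weightedCount-const n c v = trans (sym (*-distribˡ-sum c (toℚ ∘ v))) (cong (c *ℚ_) (sum-toℚ n v))

weightedCount-scale : ∀ {N} c (x : Fin N → ℚ) v →
                      weightedCount (λ j → c *ℚ x j) v ≡ c *ℚ weightedCount x v
weightedCount-scale c x v =
  trans (sum-cong-≗ (λ j → ℚ.*-assoc c (x j) _)) (sym (*-distribˡ-sum c (λ j → x j *ℚ toℚ (v j))))

weightedCount-false : ∀ {N} (x : Fin N → ℚ) → weightedCount x (replicate N false) ≡ 0ℚ
weightedCount-false {N} x = trans (sum-cong-≗ (λ j → ℚ.*-zeroʳ (x j))) (sum-replicate-zero N)

p*q≡p*r⇒p≡0 : ∀ p {q r} → q ≢ r → p *ℚ q ≡ p *ℚ r → p ≡ 0ℚ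
p*q≡p*r⇒p≡0 p {q} {r} q≢r pq≡pr = begin
  p                              ≡⟨ sym (ℚ.*-identityʳ p) ⟩
  p *ℚ 1ℚ                        ≡⟨ cong (p *ℚ_) (sym (ℚ.*-inverseʳ (q - r))) ⟩
  p *ℚ ((q - r) *ℚ 1/ (q - r))   ≡⟨ sym (ℚ.*-assoc p (q - r) _) ⟩
  p *ℚ (q - r) *ℚ 1/ (q - r)     ≡⟨ cong (_*ℚ 1/ (q - r)) p[q-r]≡0 ⟩
  0ℚ *ℚ 1/ (q - r)               ≡⟨ ℚ.*-zeroˡ (1/ (q - r)) ⟩
  0ℚ                             ∎
  where
  open ≡-Reasoning
  instance
    q-r≢0 : NonZeroℚ (q - r)
    q-r≢0 = ≢-nonZero (q≢r ∘ x∙y⁻¹≈ε⇒x≈y q r)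
  p[q-r]≡0 : p *ℚ (q - r) ≡ 0ℚ
  p[q-r]≡0 = begin
    p *ℚ (q - r)             ≡⟨ ℚ.*-distribˡ-+ p q (- r) ⟩
    p *ℚ q +ℚ p *ℚ (- r)     ≡⟨ cong₂ _+ℚ_ pq≡pr (sym (ℚ.neg-distribʳ-* p r)) ⟩
    p *ℚ r +ℚ - (p *ℚ r)     ≡⟨ ℚ.+-inverseʳ (p *ℚ r) ⟩
    0ℚ                       ∎

toℚ-not : ∀ b → toℚ (not b) +ℚ toℚ b ≡ 1ℚ
toℚ-not true  = refl
toℚ-not false = refl

rowCombination : ∀ {N r} → Mat01 N → (Fin r → Fin N) → (Fin r → ℚ) → Fin N → ℚ
rowCombination {r = r} A ρ c j = sumℚ r (λ t → c t *ℚ toℚ (A (ρ t) j))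

rowCombination-compl : ∀ {N r} (A : Mat01 N) (ρ : Fin r → Fin N) c j →
  rowCombination (compl A) ρ c j +ℚ rowCombination A ρ c j ≡ sum c
rowCombination-compl {r = r} A ρ c j = begin
  rowCombination (compl A) ρ c j +ℚ rowCombination A ρ c j
    ≡⟨ cong₂ _+ℚ_ (sumℚ≡sum r _) (sumℚ≡sum r _) ⟩
  ∑[ t < r ] (c t *ℚ toℚ (not (a t))) +ℚ ∑[ t < r ] (c t *ℚ toℚ (a t))
    ≡⟨ ∑-distrib-+ (λ t → c t *ℚ toℚ (not (a t))) (λ t → c t *ℚ toℚ (a t)) ⟨
  ∑[ t < r ] (c t *ℚ toℚ (not (a t)) +ℚ c t *ℚ toℚ (a t))
    ≡⟨ sum-cong-≗ (λ t → ℚ.*-distribˡ-+ (c t) _ _) ⟨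
  ∑[ t < r ] (c t *ℚ (toℚ (not (a t)) +ℚ toℚ (a t)))
    ≡⟨ sum-cong-≗ (λ t → trans (cong (c t *ℚ_) (toℚ-not (a t))) (ℚ.*-identityʳ (c t))) ⟩
  sum c ∎
  where
  open ≡-Reasoning
  a : Fin r → Bool
  a t = A (ρ t) j

hasRank-cong : ∀ {N} {A B : Mat01 N} →
  (∀ r ρ → RowsIndependent A r ρ ⇔ RowsIndependent B r ρ) →
  ∀ r → HasRank A r ⇔ HasRank B r
hasRank-cong {A = A} {B} independent⇔ r = mk⇔ to from
  where
  to : HasRank A r → HasRank B r
  to ((ρ , independent) , maximal) =
    (ρ , Equivalence.to (independent⇔ r ρ) independent) ,
    λ ρ′ → maximal ρ′ ∘ Equivalence.from (independent⇔ (suc r) ρ′)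
  from : HasRank B r → HasRank A r
  from ((ρ , independent) , maximal) =
    (ρ , Equivalence.from (independent⇔ r ρ) independent) ,
    λ ρ′ → maximal ρ′ ∘ Equivalence.to (independent⇔ (suc r) ρ′)

module _ {N : ℕ} (A : Mat01 N) {x : Fin N → ℚ} {D S : ℚ} (D≢0 : D ≢ 0ℚ) (D≢S : D ≢ S)
         (rowSums : ∀ a → weightedCount x (A a) ≡ D) (total : sum x ≡ S) where

  constant-rowCombination : ∀ {r} (ρ : Fin r → Fin N) c {v} →
    (∀ j → rowCombination A ρ c j ≡ v) → sum c *ℚ D ≡ S *ℚ v
  constant-rowCombination {r} ρ c {v} combination≡v = begin
    sum c *ℚ D
      ≡⟨ *-distribʳ-sum D c ⟩
    ∑[ t < r ] (c t *ℚ D)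
      ≡⟨ sum-cong-≗ (λ t → cong (c t *ℚ_) (rowSums (ρ t))) ⟨
    ∑[ t < r ] (c t *ℚ weightedCount x (A (ρ t)))
      ≡⟨ sum-cong-≗ (λ t → *-distribˡ-sum (c t) (λ j → x j *ℚ a t j)) ⟩
    ∑[ t < r ] ∑[ j < N ] (c t *ℚ (x j *ℚ a t j))
      ≡⟨ sum-cong-≗ (λ t → sum-cong-≗ (λ j → x∙yz≈y∙xz (c t) (x j) (a t j))) ⟩
    ∑[ t < r ] ∑[ j < N ] (x j *ℚ (c t *ℚ a t j))
      ≡⟨ ∑-comm (λ t j → x j *ℚ (c t *ℚ a t j)) ⟩
    ∑[ j < N ] ∑[ t < r ] (x j *ℚ (c t *ℚ a t j))
      ≡⟨ sum-cong-≗ (λ j → *-distribˡ-sum (x j) (λ t → c t *ℚ a t j)) ⟨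
    ∑[ j < N ] (x j *ℚ ∑[ t < r ] (c t *ℚ a t j))
      ≡⟨ sum-cong-≗ (λ j → cong (x j *ℚ_) (trans (sym (sumℚ≡sum r _)) (combination≡v j))) ⟩
    ∑[ j < N ] (x j *ℚ v)
      ≡⟨ *-distribʳ-sum v x ⟨
    sum x *ℚ v
      ≡⟨ cong (_*ℚ v) total ⟩
    S *ℚ v ∎
    where
    open ≡-Reasoning
    a : Fin r → Fin N → ℚ
    a t j = toℚ (A (ρ t) j)

  independent⇒compl-independent : ∀ {r ρ} → RowsIndependent A r ρ → RowsIndependent (compl A) r ρ
  independent⇒compl-independent {ρ = ρ} independent c complCombination≡0 =
    independent c (λ j → trans (combination≡∑c j) ∑c≡0)
    where
    combination≡∑c : ∀ j → rowCombination A ρ c j ≡ sum c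
    combination≡∑c j = begin
      rowCombination A ρ c j                                    ≡⟨ ℚ.+-identityˡ _ ⟨
      0ℚ +ℚ rowCombination A ρ c j                              ≡⟨ cong (_+ℚ rowCombination A ρ c j) (complCombination≡0 j) ⟨
      rowCombination (compl A) ρ c j +ℚ rowCombination A ρ c j  ≡⟨ rowCombination-compl A ρ c j ⟩
      sum c                                                     ∎
      where open ≡-Reasoning
    ∑c≡0 : sum c ≡ 0ℚ
    ∑c≡0 = p*q≡p*r⇒p≡0 (sum c) D≢S
             (trans (constant-rowCombination ρ c combination≡∑c) (ℚ.*-comm S (sum c)))

  compl-independent⇒independent : ∀ {r ρ} → RowsIndependent (compl A) r ρ → RowsIndependent A r ρ
  compl-independent⇒independent {ρ = ρ} independent c combination≡0 =
    independent c (λ j → trans (complCombination≡∑c j) ∑c≡0)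
    where
    complCombination≡∑c : ∀ j → rowCombination (compl A) ρ c j ≡ sum c
    complCombination≡∑c j = begin
      rowCombination (compl A) ρ c j                            ≡⟨ ℚ.+-identityʳ _ ⟨
      rowCombination (compl A) ρ c j +ℚ 0ℚ                      ≡⟨ cong (rowCombination (compl A) ρ c j +ℚ_) (combination≡0 j) ⟨
      rowCombination (compl A) ρ c j +ℚ rowCombination A ρ c j  ≡⟨ rowCombination-compl A ρ c j ⟩
      sum c                                                     ∎
      where open ≡-Reasoning
    ∑c≡0 : sum c ≡ 0ℚ
    ∑c≡0 = p*q≡p*r⇒p≡0 (sum c) D≢0
             (trans (constant-rowCombination ρ c combination≡0)
                    (trans (ℚ.*-zeroʳ S) (sym (ℚ.*-zeroʳ (sum c)))))

  hasRank-compl : ∀ r → HasRank A r ⇔ HasRank (compl A) r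
  hasRank-compl = hasRank-cong {A = A} {B = compl A} λ r ρ →
    mk⇔ (independent⇒compl-independent {r} {ρ}) (compl-independent⇒independent {r} {ρ})

∏ : (m : ℕ) → (Fin m → ℕ) → ℕ
∏ zero    k = 1
∏ (suc m) k = k zero * ∏ m (k ∘ suc)

-- Column weight ∏_{l ≠ i} k_l on block i, with total Σ_i n_i ∏_{l ≠ i} k_l.
weights : (m : ℕ) (n k : Fin m → ℕ) → Fin (sumSizes m n) → ℚ
weights zero    n k ()
weights (suc m) n k = replicate (n zero) (fromℕ (∏ m (k ∘ suc)))
                   ++ λ j → fromℕ (k zero) *ℚ weights m (n ∘ suc) (k ∘ suc) j

totalWeight : (m : ℕ) (n k : Fin m → ℕ) → ℕ
totalWeight zero    n k = 0
totalWeight (suc m) n k = n zero * ∏ m (k ∘ suc) + k zero * totalWeight m (n ∘ suc) (k ∘ suc)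

sum-weights : ∀ m (n k : Fin m → ℕ) → sum (weights m n k) ≡ fromℕ (totalWeight m n k)
sum-weights zero    n k = refl
sum-weights (suc m) n k = begin
  sum (weights (suc m) n k)
    ≡⟨ sum-++ ℚ.+-0-monoid (replicate (n zero) (fromℕ P′)) w′ ⟩
  sum (replicate (n zero) (fromℕ P′)) +ℚ sum w′
    ≡⟨ cong₂ _+ℚ_ (sum-const (n zero) (fromℕ P′))
                  (sym (*-distribˡ-sum (fromℕ (k zero)) (weights m (n ∘ suc) (k ∘ suc)))) ⟩
  fromℕ (n zero) *ℚ fromℕ P′ +ℚ fromℕ (k zero) *ℚ sum (weights m (n ∘ suc) (k ∘ suc))
    ≡⟨ cong (λ s → fromℕ (n zero) *ℚ fromℕ P′ +ℚ fromℕ (k zero) *ℚ s) (sum-weights m (n ∘ suc) (k ∘ suc)) ⟩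
  fromℕ (n zero) *ℚ fromℕ P′ +ℚ fromℕ (k zero) *ℚ fromℕ S′
    ≡⟨ cong₂ _+ℚ_ (fromℕ-* (n zero) P′) (fromℕ-* (k zero) S′) ⟨
  fromℕ (n zero * P′) +ℚ fromℕ (k zero * S′)
    ≡⟨ fromℕ-+ (n zero * P′) (k zero * S′) ⟨
  fromℕ (totalWeight (suc m) n k) ∎
  where
  open ≡-Reasoning
  P′ = ∏ m (k ∘ suc)
  S′ = totalWeight m (n ∘ suc) (k ∘ suc)
  w′ : Fin (sumSizes m (n ∘ suc)) → ℚ
  w′ j = fromℕ (k zero) *ℚ weights m (n ∘ suc) (k ∘ suc) j

module _ {m : ℕ} (n : Fin (suc m) → ℕ) (B : (i : Fin (suc m)) → Mat01 (n i)) where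

  blockRow : Fin (n zero) ⊎ Fin (sumSizes m (n ∘ suc)) → Fin (sumSizes (suc m) n) → Bool
  blockRow (inj₁ a) = B zero a ++ replicate _ false
  blockRow (inj₂ a) = replicate (n zero) false ++ blockDiag m (n ∘ suc) (B ∘ suc) a

  blockDiag-row : ∀ a b → blockDiag (suc m) n B a b ≡ blockRow (splitAt (n zero) a) b
  blockDiag-row a b with splitAt (n zero) a
  ... | inj₁ _ with splitAt (n zero) b
  ...   | inj₁ _ = refl
  ...   | inj₂ _ = refl
  blockDiag-row a b | inj₂ _ with splitAt (n zero) b
  ...   | inj₁ _ = refl
  ...   | inj₂ _ = refl

weightedCount-blockDiag : ∀ m (n k : Fin m → ℕ) (B : (i : Fin m) → Mat01 (n i)) →
  (∀ i a → count (n i) (B i a) ≡ k i) →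
  ∀ a → weightedCount (weights m n k) (blockDiag m n B a) ≡ fromℕ (∏ m k)
weightedCount-blockDiag (suc m) n k B rowCounts a =
  trans (weightedCount-cong (weights (suc m) n k) (blockDiag-row n B a))
        (weightedCount-blockRow (splitAt (n zero) a))
  where
  open ≡-Reasoning
  P′ = ∏ m (k ∘ suc)
  R = sumSizes m (n ∘ suc)
  w′ : Fin R → ℚ
  w′ = weights m (n ∘ suc) (k ∘ suc)
  weightedCount-blockRow : ∀ s →
    weightedCount (weights (suc m) n k) (blockRow n B s) ≡ fromℕ (∏ (suc m) k)
  weightedCount-blockRow (inj₁ a′) = begin
    weightedCount (weights (suc m) n k) (blockRow n B (inj₁ a′))
      ≡⟨ weightedCount-++ (replicate (n zero) (fromℕ P′)) (λ j → fromℕ (k zero) *ℚ w′ j)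
                          (B zero a′) (replicate R false) ⟩
    weightedCount (replicate (n zero) (fromℕ P′)) (B zero a′)
      +ℚ weightedCount (λ j → fromℕ (k zero) *ℚ w′ j) (replicate R false)
      ≡⟨ cong₂ _+ℚ_ (weightedCount-const (n zero) (fromℕ P′) (B zero a′))
                    (weightedCount-false (λ j → fromℕ (k zero) *ℚ w′ j)) ⟩
    fromℕ P′ *ℚ fromℕ (count (n zero) (B zero a′)) +ℚ 0ℚ
      ≡⟨ ℚ.+-identityʳ _ ⟩
    fromℕ P′ *ℚ fromℕ (count (n zero) (B zero a′))
      ≡⟨ cong (λ c → fromℕ P′ *ℚ fromℕ c) (rowCounts zero a′) ⟩
    fromℕ P′ *ℚ fromℕ (k zero)
      ≡⟨ ℚ.*-comm (fromℕ P′) (fromℕ (k zero)) ⟩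
    fromℕ (k zero) *ℚ fromℕ P′
      ≡⟨ fromℕ-* (k zero) P′ ⟨
    fromℕ (∏ (suc m) k) ∎
  weightedCount-blockRow (inj₂ a′) = begin
    weightedCount (weights (suc m) n k) (blockRow n B (inj₂ a′))
      ≡⟨ weightedCount-++ (replicate (n zero) (fromℕ P′)) (λ j → fromℕ (k zero) *ℚ w′ j)
                          (replicate (n zero) false) (blockDiag m (n ∘ suc) (B ∘ suc) a′) ⟩
    weightedCount (replicate (n zero) (fromℕ P′)) (replicate (n zero) false)
      +ℚ weightedCount (λ j → fromℕ (k zero) *ℚ w′ j) (blockDiag m (n ∘ suc) (B ∘ suc) a′)
      ≡⟨ cong₂ _+ℚ_ (weightedCount-false (replicate (n zero) (fromℕ P′)))
                    (weightedCount-scale (fromℕ (k zero)) w′ (blockDiag m (n ∘ suc) (B ∘ suc) a′)) ⟩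
    0ℚ +ℚ fromℕ (k zero) *ℚ weightedCount w′ (blockDiag m (n ∘ suc) (B ∘ suc) a′)
      ≡⟨ ℚ.+-identityˡ _ ⟩
    fromℕ (k zero) *ℚ weightedCount w′ (blockDiag m (n ∘ suc) (B ∘ suc) a′)
      ≡⟨ cong (fromℕ (k zero) *ℚ_)
              (weightedCount-blockDiag m (n ∘ suc) (k ∘ suc) (B ∘ suc) (rowCounts ∘ suc) a′) ⟩
    fromℕ (k zero) *ℚ fromℕ P′
      ≡⟨ fromℕ-* (k zero) P′ ⟨
    fromℕ (∏ (suc m) k) ∎

∏-pos : ∀ m {k : Fin m → ℕ} → (∀ i → 0 < k i) → 0 < ∏ m k
∏-pos zero    k>0 = s≤s z≤n
∏-pos (suc m) k>0 = ℕ.*-mono-< (k>0 zero) (∏-pos m (k>0 ∘ suc))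

∏≤totalWeight : ∀ m {n k : Fin (suc m) → ℕ} → (∀ i → k i ≤ n i) →
                ∏ (suc m) k ≤ totalWeight (suc m) n k
∏≤totalWeight m {k = k} k≤n = ℕ.≤-trans (ℕ.*-monoˡ-≤ (∏ m (k ∘ suc)) (k≤n zero)) (ℕ.m≤m+n _ _)

∏<totalWeight : ∀ m {n k : Fin (suc m) → ℕ} → (∀ i → 0 < k i) → (∀ i → k i ≤ n i) →
  k zero < n zero ⊎ 0 < m → ∏ (suc m) k < totalWeight (suc m) n k
∏<totalWeight m {k = k} k>0 k≤n (inj₁ k₀<n₀) =
  ℕ.<-≤-trans (ℕ.*-monoˡ-< (∏ m (k ∘ suc)) k₀<n₀) (ℕ.m≤m+n _ _)
  where instance _ = >-nonZero (∏-pos m (k>0 ∘ suc))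
∏<totalWeight (suc m) {k = k} k>0 k≤n (inj₂ _) =
  ℕ.≤-<-trans (ℕ.*-monoˡ-≤ (∏ (suc m) (k ∘ suc)) (k≤n zero)) (ℕ.m<m+n _ k₀S′>0)
  where
  k₀S′>0 = ℕ.*-mono-< (k>0 zero)
             (ℕ.<-≤-trans (∏-pos (suc m) (k>0 ∘ suc)) (∏≤totalWeight m (k≤n ∘ suc)))

count≤n : ∀ n (v : Fin n → Bool) → count n v ≤ n
count≤n zero    v = z≤n
count≤n (suc n) v with v zero
... | true  = s≤s (count≤n n (v ∘ suc))
... | false = ℕ.m≤n⇒m≤1+n (count≤n n (v ∘ suc))

count≡n⇒all-true : ∀ n (v : Fin n → Bool) → count n v ≡ n → ∀ b → v b ≡ true
count≡n⇒all-true (suc n) v count≡n b with v zero in v₀≡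
count≡n⇒all-true (suc n) v count≡n zero    | true  = v₀≡
count≡n⇒all-true (suc n) v count≡n (suc b) | true  = count≡n⇒all-true n (v ∘ suc) (ℕ.suc-injective count≡n) b
count≡n⇒all-true (suc n) v count≡n b       | false =
  ⊥-elim (ℕ.<-irrefl count≡n (s≤s (count≤n n (v ∘ suc))))

regular-full⇒AllOne : ∀ {n} {A : Mat01 n} → IsRegular n n A → AllOne A
regular-full⇒AllOne {n} {A} (rowCounts , _) a = count≡n⇒all-true n (A a) (rowCounts a)

AllOne-blockDiag₁ : ∀ (n : Fin 1 → ℕ) (B : (i : Fin 1) → Mat01 (n i)) →
                    AllOne (B zero) → AllOne (blockDiag 1 n B)
AllOne-blockDiag₁ n B allOne a b with splitAt (n zero) a | splitAt (n zero) b
... | inj₁ a′ | inj₁ b′ = allOne a′ b′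
... | inj₁ _  | inj₂ ()
... | inj₂ () | _

¬AllOne⇒k₀<n₀⊎0<m : ∀ m {n k : Fin (suc m) → ℕ} {B : (i : Fin (suc m)) → Mat01 (n i)} →
  (∀ i → k i ≤ n i) → (∀ i → IsRegular (n i) (k i) (B i)) →
  ¬ AllOne (blockDiag (suc m) n B) → k zero < n zero ⊎ 0 < m
¬AllOne⇒k₀<n₀⊎0<m zero {n} {k} {B} k≤n regular ¬allOne = inj₁ (ℕ.≤∧≢⇒< (k≤n zero) k₀≢n₀)
  where
  k₀≢n₀ : k zero ≢ n zero
  k₀≢n₀ k₀≡n₀ = ¬allOne (AllOne-blockDiag₁ n B (regular-full⇒AllOne
    (subst (λ c → IsRegular (n zero) c (B zero)) k₀≡n₀ (regular zero))))
¬AllOne⇒k₀<n₀⊎0<m (suc m) _ _ _ = inj₂ (s≤s z≤n)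

lemma2p3 : (m : ℕ) → 1 ≤ m →
    (n k : Fin m → ℕ) → (B : (i : Fin m) → Mat01 (n i)) →
    ((i : Fin m) → 0 < k i) → ((i : Fin m) → k i ≤ n i) →
    ((i : Fin m) → IsRegular (n i) (k i) (B i)) →
    ¬ AllOne (blockDiag m n B) →
    (r : ℕ) → HasRank (blockDiag m n B) r ⇔ HasRank (compl (blockDiag m n B)) r
lemma2p3 (suc m) _ n k B k>0 k≤n regular ¬allOne =
  hasRank-compl (blockDiag (suc m) n B) D≢0 D≢S
    (weightedCount-blockDiag (suc m) n k B (λ i → proj₁ (regular i)))
    (sum-weights (suc m) n k)
  where
  D≢0 : fromℕ (∏ (suc m) k) ≢ 0ℚ
  D≢0 = ≢-sym (ℚ.<⇒≢ (fromℕ-mono-< (∏-pos (suc m) k>0)))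
  D≢S : fromℕ (∏ (suc m) k) ≢ fromℕ (totalWeight (suc m) n k)
  D≢S = ℚ.<⇒≢ (fromℕ-mono-< (∏<totalWeight m k>0 k≤n (¬AllOne⇒k₀<n₀⊎0<m m k≤n regular ¬allOne)))
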